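{- Let $S$ be a finite set with $|S| \geq 2$. Let $\Upsilon$ be any hierarchical division of $S$, and let $\mathcal{C}$ be any partition of $S$ other than $\{S\}$. Then there exist $C_1, C_2 \in \mathcal{C}$ with $C_1 \neq C_2$, and there exist $C_1' \subseteq C_1$ and $C_2' \subseteq C_2$, such that $C_1'$ and $C_2'$ are siblings in $\Upsilon$.
   Context: A partition of a finite set $S$ is a collection $\mathcal{C} = \{C_1,\ldots,C_k\}$ of subsets of $S$ with $\bigcup_{i} C_i = S$ and $C_i \cap C_j = \emptyset$ for $i \neq j$. A hierarchical division of $S$ is a full binary tree $\Upsilon$ (every internal node has exactly two children) whose nodes represent subsets of $S$, such that the root represents $S$, the $|S|$ leaves represent the singleton sets $\{x\}$ for each $x \in S$, and the set of each internal node is the disjoint union of the sets of its two children. Two nodes are siblings if they are the two children of the same internal node. -}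

module Defs where

open import Data.Nat using (ℕ)
open import Data.Fin using (Fin)
open import Data.Fin.Subset using (Subset; ⁅_⁆; _∪_; _∈_; ⊤; Nonempty)
open import Data.List using (List)
open import Data.List.Relation.Unary.All using (All)
open import Data.List.Relation.Unary.Any using (Any)
open import Data.List.Relation.Unary.AllPairs using (AllPairs)
open import Data.Product using (_×_)
open import Data.Empty using (⊥)
import Data.Unit as Unit
open import Relation.Binary.PropositionalEquality using (_≡_)

-- The finite set S is modelled as Fin n (|S| = n); subsets are Subset n.

Disjoint : ∀ {n} → Subset n → Subset n → Set
Disjoint p q = ∀ x → x ∈ p → x ∈ q → ⊥

data Tree (n : ℕ) : Set where
  leaf : Fin n → Tree n
  node : Tree n → Tree n → Tree n

set : ∀ {n} → Tree n → Subset n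
set (leaf x)   = ⁅ x ⁆
set (node l r) = set l ∪ set r

DisjointUnions : ∀ {n} → Tree n → Set
DisjointUnions (leaf x)   = Unit.⊤
DisjointUnions (node l r) = Disjoint (set l) (set r) × DisjointUnions l × DisjointUnions r

-- A hierarchical division of S = Fin n: a full binary tree whose root
-- represents S and whose internal nodes are disjoint unions of their
-- children (hence the leaves are exactly the n singletons).
record HierarchicalDivision (n : ℕ) : Set where
  field
    tree      : Tree n
    root-is-S : set tree ≡ ⊤
    disjoint  : DisjointUnions tree
open HierarchicalDivision public

data Siblings {n} (A B : Subset n) : Tree n → Set where
  here  : ∀ {l r} → set l ≡ A → set r ≡ B → Siblings A B (node l r)
  here′ : ∀ {l r} → set l ≡ B → set r ≡ A → Siblings A B (node l r)
  left  : ∀ {l r} → Siblings A B l → Siblings A B (node l r)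
  right : ∀ {l r} → Siblings A B r → Siblings A B (node l r)

-- A partition of S = Fin n, given as a list of blocks: blocks are nonempty,
-- pairwise disjoint, and cover S.  (Nonempty + pairwise disjoint implies no
-- duplicates, so the list faithfully represents the set of blocks.)
record IsPartition {n} (C : List (Subset n)) : Set where
  field
    nonempty : All Nonempty C
    pairwise : AllPairs Disjoint C
    covers   : ∀ x → Any (x ∈_) C

-- Call a node of Υ small if its set lies inside a single block of C.  Every
-- leaf is small because C covers S, while the root is not, since the only
-- block containing S would be all of C.  Descending from the root through
-- children that are not small, we must stop at a node that is not small but
-- whose two children are; these children lie in blocks C₁ and C₂, and
-- C₁ ≢ C₂ because otherwise the node itself would be small.
module Submission where

open import Defs
open import Data.Nat using (ℕ; _≥_)
open import Data.Fin.Subset using (Subset; _⊆_; ⊤)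
open import Data.List using (List; _∷_; [])
open import Data.List.Membership.Propositional using (_∈_)
open import Data.Product using (Σ; _×_)
open import Relation.Binary.PropositionalEquality using (_≡_; _≢_)
open import Relation.Nullary using (¬_)

open import Data.Bool as Bool using ()
open import Data.Empty using (⊥-elim)
open import Data.Fin using (Fin)
open import Data.Fin.Subset using (⁅_⁆; _∪_; Nonempty)
import Data.Fin.Subset as Subset
open import Data.Fin.Subset.Properties using (_⊆?_; ⊆-antisym; ⊆⊤; ∈⊤; x∈⁅y⁆⇒x≡y; x∈p∪q⁻)
open import Data.List.Membership.Propositional using (find; lose)
open import Data.List.Relation.Unary.All using (All; _∷_; [])
import Data.List.Relation.Unary.All as All
open import Data.List.Relation.Unary.AllPairs using (AllPairs; _∷_)
open import Data.List.Relation.Unary.Any using (Any; here; there; any?)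
import Data.List.Relation.Unary.Any as Any
open import Data.Product using (_,_)
open import Data.Sum using ([_,_])
open import Data.Vec.Properties using (≡-dec)
open import Relation.Binary.PropositionalEquality using (refl; cong; subst; sym)
open import Relation.Nullary using (Dec; yes; no)

private
  variable
    n : ℕ
    p q r : Subset n

⁅x⁆⊆p : ∀ {x : Fin n} → x Subset.∈ p → ⁅ x ⁆ ⊆ p
⁅x⁆⊆p {x = x} x∈p {y} y∈⁅x⁆ = subst (Subset._∈ _) (sym (x∈⁅y⁆⇒x≡y x y∈⁅x⁆)) x∈p

∪-least : p ⊆ r → q ⊆ r → p ∪ q ⊆ r
∪-least {p = p} {q = q} p⊆r q⊆r x∈p∪q = [ p⊆r , q⊆r ] (x∈p∪q⁻ p q x∈p∪q)

Disjoint-⊤⊆ʳ : Disjoint p q → ⊤ ⊆ q → ¬ Nonempty p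
Disjoint-⊤⊆ʳ p#q ⊤⊆q (x , x∈p) = p#q x x∈p (⊤⊆q ∈⊤)

Disjoint-⊤⊆ˡ : Disjoint p q → ⊤ ⊆ p → ¬ Nonempty q
Disjoint-⊤⊆ˡ p#q ⊤⊆p (x , x∈q) = p#q x (⊤⊆p ∈⊤) x∈q

InsideBlock : List (Subset n) → Subset n → Set
InsideBlock C A = Any (A ⊆_) C

insideBlock? : (C : List (Subset n)) (A : Subset n) → Dec (InsideBlock C A)
insideBlock? C A = any? (A ⊆?_) C

leaf-insideBlock : ∀ {C : List (Subset n)} → (∀ x → Any (x Subset.∈_) C) →
                   ∀ x → InsideBlock C (set (leaf x))
leaf-insideBlock covers x = Any.map ⁅x⁆⊆p (covers x)

⊤-insideBlock⇒≡[⊤] : ∀ {C : List (Subset n)} → All Nonempty C → AllPairs Disjoint C →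
                     InsideBlock C ⊤ → C ≡ ⊤ ∷ []
⊤-insideBlock⇒≡[⊤] (_ ∷ []) _ (here ⊤⊆B) = cong (_∷ []) (⊆-antisym ⊆⊤ ⊤⊆B)
⊤-insideBlock⇒≡[⊤] (_ ∷ B′≠∅ ∷ _) ((B#B′ ∷ _) ∷ _) (here ⊤⊆B) =
  ⊥-elim (Disjoint-⊤⊆ˡ B#B′ ⊤⊆B B′≠∅)
⊤-insideBlock⇒≡[⊤] (B≠∅ ∷ _) (B#rest ∷ _) (there ⊤-inside-rest)
  with find ⊤-inside-rest
... | _ , B′∈rest , ⊤⊆B′ = ⊥-elim (Disjoint-⊤⊆ʳ (All.lookup B#rest B′∈rest) ⊤⊆B′ B≠∅)

SeparatedSiblings : List (Subset n) → Tree n → Set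
SeparatedSiblings {n} C t =
  Σ (Subset n) λ C₁ → Σ (Subset n) λ C₂ → Σ (Subset n) λ C₁′ → Σ (Subset n) λ C₂′ →
    C₁ ∈ C × C₂ ∈ C × C₁ ≢ C₂ × C₁′ ⊆ C₁ × C₂′ ⊆ C₂ × Siblings C₁′ C₂′ t

SeparatedSiblings-map : ∀ {C : List (Subset n)} {t u : Tree n} →
                        (∀ {A B} → Siblings A B t → Siblings A B u) →
                        SeparatedSiblings C t → SeparatedSiblings C u
SeparatedSiblings-map f (C₁ , C₂ , C₁′ , C₂′ , C₁∈C , C₂∈C , C₁≢C₂ , C₁′⊆C₁ , C₂′⊆C₂ , sib) =
  C₁ , C₂ , C₁′ , C₂′ , C₁∈C , C₂∈C , C₁≢C₂ , C₁′⊆C₁ , C₂′⊆C₂ , f sib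

children-insideBlock⇒separated : ∀ {C : List (Subset n)} {l r : Tree n} →
  InsideBlock C (set l) → InsideBlock C (set r) → ¬ InsideBlock C (set (node l r)) →
  SeparatedSiblings C (node l r)
children-insideBlock⇒separated l-inside r-inside ¬node-inside
  with find l-inside | find r-inside
... | C₁ , C₁∈C , l⊆C₁ | C₂ , C₂∈C , r⊆C₂ with ≡-dec Bool._≟_ C₁ C₂
...   | no C₁≢C₂ = C₁ , C₂ , _ , _ , C₁∈C , C₂∈C , C₁≢C₂ , l⊆C₁ , r⊆C₂ , here refl refl
...   | yes refl = ⊥-elim (¬node-inside (lose C₁∈C (∪-least l⊆C₁ r⊆C₂)))

separatedSiblings : ∀ {C : List (Subset n)} → (∀ x → Any (x Subset.∈_) C) →
                    (t : Tree n) → ¬ InsideBlock C (set t) → SeparatedSiblings C t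
separatedSiblings covers (leaf x) ¬inside = ⊥-elim (¬inside (leaf-insideBlock covers x))
separatedSiblings {C = C} covers (node l r) ¬inside
  with insideBlock? C (set l) | insideBlock? C (set r)
... | no ¬l-inside | _ = SeparatedSiblings-map left (separatedSiblings covers l ¬l-inside)
... | yes _ | no ¬r-inside = SeparatedSiblings-map right (separatedSiblings covers r ¬r-inside)
... | yes l-inside | yes r-inside = children-insideBlock⇒separated l-inside r-inside ¬inside

lemma3p1 : (n : ℕ) → n ≥ 2 → (Υ : HierarchicalDivision n) →
    (C : List (Subset n)) → IsPartition C → ¬ (C ≡ ⊤ ∷ []) →
    Σ (Subset n) λ C₁ → Σ (Subset n) λ C₂ → Σ (Subset n) λ C₁′ → Σ (Subset n) λ C₂′ →
    C₁ ∈ C × C₂ ∈ C × C₁ ≢ C₂ × C₁′ ⊆ C₁ × C₂′ ⊆ C₂ × Siblings C₁′ C₂′ (tree Υ)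
lemma3p1 n _ Υ C partition C≢[⊤] =
  separatedSiblings covers (tree Υ) (subst (λ S → ¬ InsideBlock C S) (sym (root-is-S Υ)) ¬⊤-inside)
  where
  open IsPartition partition
  ¬⊤-inside : ¬ InsideBlock C ⊤
  ¬⊤-inside ⊤-inside = C≢[⊤] (⊤-insideBlock⇒≡[⊤] nonempty pairwise ⊤-inside)
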